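{- Let $w$ be a pp-irreducible string and let $b\le c$ be positions of $w$. Let $f=\max\{\mathscr{F}_w(d)\mid b\le d\le c\}$. Then $f=\max\{\mathscr{F}_w(d)\mid b\le d\le f\}$.
   Context: Strings over $\Sigma$, positions $1,\dots,|w|$, $w[i:j]=w[i]\cdots w[j]$, $\overline{x}$ the reverse. Palindromes are even palindromes $x\overline{x}$; for a position $c$, $\rho_w(c)$ is the largest $r\ge 0$ with $c-r\ge0$, $c+r\le|w|$ and $w[c-r+1:c+r]$ a palindrome. A Z-shape is $x\overline{x}x$, $x$ nonempty; a string is irreducible if no Z-shape occurs in it as a substring. $w$ is pp-irreducible if $w[1:|w|-1]$ is irreducible. For a pp-irreducible $w$ and distinct positions $c,d$, write $c\sqsubset_w d$ if $c\le d-\rho_w(d)\le d\le c+\rho_w(c)\le d+\rho_w(d)$. A palindrome chain from $c_0$ in $w$ is a sequence $(c_0,\dots,c_k)$, $k\ge0$, with $c_{i-1}\sqsubset_w c_i$ for $i\in[1:k]$; its frontier is $c_k+\rho_w(c_k)$. $\mathscr{F}_w(c)$ is the maximum frontier over all palindrome chains from $c$. -}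

module Defs where

open import Data.Nat using (ℕ; _+_; _*_; _∸_; _≤_)
open import Data.List using (List; []; _++_; reverse; take; drop; length)
open import Data.Product using (Σ; ∃; _×_; _,_)
open import Relation.Binary.PropositionalEquality using (_≡_; _≢_)
open import Relation.Nullary using (¬_)

module _ {A : Set} where

  Palindrome : List A → Set
  Palindrome s = ∃ λ (x : List A) → s ≡ x ++ reverse x

  -- substring w[i:j] with positions 1..|w| (i ≥ 1): take (j-i+1) (drop (i-1) w).
  -- w[c-r+1 : c+r] is therefore take (2r) (drop (c-r) w).
  centered : List A → ℕ → ℕ → List A
  centered w c r = take (2 * r) (drop (c ∸ r) w)

  Admissible : List A → ℕ → ℕ → Set
  Admissible w c r = (r ≤ c) × (c + r ≤ length w) × Palindrome (centered w c r)

  IsRho : List A → ℕ → ℕ → Set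
  IsRho w c r = Admissible w c r × (∀ r′ → Admissible w c r′ → r′ ≤ r)

  ZShape : List A → Set
  ZShape z = ∃ λ (x : List A) → (x ≢ []) × (z ≡ x ++ reverse x ++ x)

  Irreducible : List A → Set
  Irreducible w = ¬ (∃ λ (u : List A) → ∃ λ (z : List A) → ∃ λ (v : List A) →
                       ZShape z × (w ≡ u ++ z ++ v))

  PPIrreducible : List A → Set
  PPIrreducible w = Irreducible (take (length w ∸ 1) w)

  -- c ⊏_w d  :  c ≤ d - ρ(d) ≤ d ≤ c + ρ(c) ≤ d + ρ(d), c ≠ d
  _⊏[_]_ : ℕ → List A → ℕ → Set
  c ⊏[ w ] d = (c ≢ d) × ∃ λ rc → ∃ λ rd → IsRho w c rc × IsRho w d rd ×
               (c + rd ≤ d) × (d ∸ rd ≤ d) × (d ≤ c + rc) × (c + rc ≤ d + rd)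

  -- Chain w c f : there is a palindrome chain (c = c₀, …, c_k) from c with frontier f = c_k + ρ(c_k)
  data Chain (w : List A) : ℕ → ℕ → Set where
    done : ∀ {c r} → IsRho w c r → Chain w c (c + r)
    step : ∀ {c d f} → c ⊏[ w ] d → Chain w d f → Chain w c f

  IsF : List A → ℕ → ℕ → Set
  IsF w c f = Chain w c f × (∀ f′ → Chain w c f′ → f′ ≤ f)

  IsMaxF : List A → ℕ → ℕ → ℕ → Set
  IsMaxF w b e f = (∃ λ d → (b ≤ d) × (d ≤ e) × IsF w d f)
                 × (∀ d g → b ≤ d → d ≤ e → IsF w d g → g ≤ f)

module Submission where

-- An admissible radius r at centre c says that the characters w[c-1-j] and
-- w[c+j] agree for every j < r (a "mirror" of radius r at c).  Two
-- adjacent mirrors of the same radius δ > 0, centred at a+δ and a+2δ,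
-- spell the Z-shape x x̄ x with x = w[a, a+δ); hence in a pp-irreducible
-- string, if c < d ≤ c + ρ(c), the palindrome at d cannot reach left of c
-- (`inner-radius-bound`).  This turns every overlap d ∈ [c, c+ρ(c)] with
-- c + ρ(c) ≤ d + ρ(d) into a link c ⊏ d, and yields the domination lemma:
-- if a chain from x has frontier f and x ≤ d ≤ f, then every chain from d
-- is outreached by some chain from x (`chain-dominates`).  The corollary
-- follows: for the position d₀ ≤ c realising f = max 𝓕 on [b, c], every
-- d ∈ (c, f] lies inside the frontier of an optimal chain from d₀, so
-- 𝓕(d) ≤ 𝓕(d₀) = f; positions d ≤ c are covered by the hypothesis.

open import Defs
open import Data.Nat using (ℕ; zero; suc; _+_; _*_; _∸_; _≤_; _<_; z≤n; s≤s; _≤?_; _≟_)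
open import Data.Nat.Properties
open import Data.List using (List; []; _∷_; _++_; [_]; reverse; take; drop; length)
open import Data.List.Properties
  using (length-take; length-drop; length-++; length-reverse; take++drop≡id; drop-drop; unfold-reverse; ++-assoc)
open import Data.Maybe using (Maybe; just; nothing)
open import Data.Product using (∃; _×_; _,_; proj₁)
open import Data.Empty using (⊥; ⊥-elim)
open import Relation.Nullary using (yes; no)
open import Relation.Binary.PropositionalEquality hiding ([_])

-- Arithmetic of mirror-image positions: i + 1 + j = r means that index i
-- from the left and index j from the right of a block of length r meet.
+-suc-swap : ∀ m n → m + suc n ≡ n + suc m
+-suc-swap m n = trans (+-suc m n) (trans (cong suc (+-comm m n)) (sym (+-suc n m)))

summand<ˡ : ∀ {i j r} → i + suc j ≡ r → i < r
summand<ˡ {i} eq = subst (i <_) eq (m<m+n i (s≤s z≤n))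

shift : ∀ a {i j δ} → i + suc j ≡ δ → a + i + suc j ≡ a + δ
shift a {i} {j} eq = trans (+-assoc a i (suc j)) (cong (a +_) eq)

twice : ∀ r → 2 * r ≡ r + r
twice r = cong (r +_) (+-identityʳ r)

double-injective : ∀ {m n} → m + m ≡ n + n → m ≡ n
double-injective {m} {n} eq = *-cancelˡ-≡ m n 2 (trans (twice m) (trans eq (sym (twice n))))

module _ {A : Set} where

  at : List A → ℕ → Maybe A
  at []       _       = nothing
  at (x ∷ xs) zero    = just x
  at (x ∷ xs) (suc i) = at xs i

  at-ext : ∀ (xs ys : List A) → length xs ≡ length ys →
           (∀ i → i < length xs → at xs i ≡ at ys i) → xs ≡ ys
  at-ext []       []       _   _ = refl
  at-ext (x ∷ xs) (y ∷ ys) len agree with agree 0 (s≤s z≤n)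
  ... | refl = cong (x ∷_) (at-ext xs ys (suc-injective len) (λ i i< → agree (suc i) (s≤s i<)))

  at-take : ∀ n (xs : List A) {i} → i < n → at (take n xs) i ≡ at xs i
  at-take (suc n) []       _       = refl
  at-take (suc n) (x ∷ xs) {zero}  _ = refl
  at-take (suc n) (x ∷ xs) {suc i} (s≤s i<n) = at-take n xs i<n

  at-drop : ∀ n (xs : List A) i → at (drop n xs) i ≡ at xs (n + i)
  at-drop zero    xs       i = refl
  at-drop (suc n) []       i = refl
  at-drop (suc n) (x ∷ xs) i = at-drop n xs i

  at-++ˡ : ∀ (xs ys : List A) {i} → i < length xs → at (xs ++ ys) i ≡ at xs i
  at-++ˡ (x ∷ xs) ys {zero}  _ = refl
  at-++ˡ (x ∷ xs) ys {suc i} (s≤s i<) = at-++ˡ xs ys i<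

  at-++ʳ : ∀ (xs ys : List A) i → at (xs ++ ys) (length xs + i) ≡ at ys i
  at-++ʳ []       ys i = refl
  at-++ʳ (x ∷ xs) ys i = at-++ʳ xs ys i

  at-reverse : ∀ (xs : List A) {i j} → i + suc j ≡ length xs → at (reverse xs) i ≡ at xs j
  at-reverse [] {i} {j} eq with () ← trans (sym (+-suc i j)) eq
  at-reverse (x ∷ xs) {i} {zero} eq rewrite unfold-reverse x xs =
    subst (λ k → at (reverse xs ++ [ x ]) k ≡ just x) (sym i≡) (at-++ʳ (reverse xs) [ x ] 0)
    where
    i≡ : i ≡ length (reverse xs) + 0
    i≡ = trans (suc-injective (trans (sym (+-comm i 1)) eq))
               (sym (trans (+-identityʳ _) (length-reverse xs)))
  at-reverse (x ∷ xs) {i} {suc j} eq rewrite unfold-reverse x xs =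
    trans (at-++ˡ (reverse xs) [ x ] i<) (at-reverse xs eq′)
    where
    eq′ : i + suc j ≡ length xs
    eq′ = suc-injective (trans (sym (+-suc i (suc j))) eq)
    i< : i < length (reverse xs)
    i< = subst (i <_) (sym (length-reverse xs)) (summand<ˡ eq′)

  slice : ℕ → ℕ → List A → List A
  slice i n v = take n (drop i v)

  at-slice : ∀ i n (v : List A) {j} → j < n → at (slice i n v) j ≡ at v (i + j)
  at-slice i n v {j} j<n = trans (at-take n (drop i v) j<n) (at-drop i v j)

  length-slice : ∀ i n (v : List A) → i + n ≤ length v → length (slice i n v) ≡ n
  length-slice i n v i+n≤ =
    trans (length-take n (drop i v))
          (m≤n⇒m⊓n≡m (subst (n ≤_) (sym (length-drop i v))
                              (m+n≤o⇒m≤o∸n n (subst (_≤ length v) (+-comm i n) i+n≤))))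

  drop-slice : ∀ i n (v : List A) → drop i v ≡ slice i n v ++ drop (i + n) v
  drop-slice i n v = sym (begin
    take n (drop i v) ++ drop (i + n) v   ≡⟨ cong (take n (drop i v) ++_) (drop-drop i n v) ⟨
    take n (drop i v) ++ drop n (drop i v) ≡⟨ take++drop≡id n (drop i v) ⟩
    drop i v                               ∎)
    where open ≡-Reasoning

  palindrome-mirror : ∀ (y : List A) {i j} → i + suc j ≡ length y →
                      at (y ++ reverse y) i ≡ at (y ++ reverse y) (length y + j)
  palindrome-mirror y {i} {j} eq = begin
    at (y ++ reverse y) i              ≡⟨ at-++ˡ y (reverse y) (summand<ˡ eq) ⟩
    at y i                             ≡⟨ at-reverse y (trans (+-suc-swap j i) eq) ⟨
    at (reverse y) j                   ≡⟨ at-++ʳ y (reverse y) j ⟨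
    at (y ++ reverse y) (length y + j) ∎
    where open ≡-Reasoning

  -- A mirror of radius r at centre c (between indices c-1 and c):
  -- w[k] = w[c+j] whenever k + 1 + j = c and j < r.
  Mirror : List A → ℕ → ℕ → Set
  Mirror w c r = ∀ {k j} → j < r → k + suc j ≡ c → at w k ≡ at w (c + j)

  mirror-shrink : ∀ (w : List A) {c r s} → s ≤ r → Mirror w c r → Mirror w c s
  mirror-shrink w s≤r m j<s = m (<-≤-trans j<s s≤r)

  mirror-take : ∀ (w : List A) n {c r} → c + r ≤ n → Mirror w c r → Mirror (take n w) c r
  mirror-take w n {c} {r} c+r≤n m {k} {j} j<r eq = begin
    at (take n w) k       ≡⟨ at-take n w (≤-trans (summand<ˡ eq) (≤-trans (m≤m+n c r) c+r≤n)) ⟩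
    at w k                ≡⟨ m j<r eq ⟩
    at w (c + j)          ≡⟨ at-take n w (<-≤-trans (+-monoʳ-< c j<r) c+r≤n) ⟨
    at (take n w) (c + j) ∎
    where open ≡-Reasoning

  admissible⇒mirror : ∀ (w : List A) {c r} → Admissible w c r → Mirror w c r
  admissible⇒mirror w {c} {r} (r≤c , c+r≤ , y , s≡) {k} {j} j<r eq = begin
    at w k                             ≡⟨ cong (at w) k≡a+i ⟩
    at w (a + i)                       ≡⟨ at-slice a (2 * r) w i<2r ⟨
    at s i                             ≡⟨ cong (λ t → at t i) s≡ ⟩
    at (y ++ reverse y) i              ≡⟨ palindrome-mirror y (trans i+j≡r (sym |y|≡r)) ⟩
    at (y ++ reverse y) (length y + j) ≡⟨ cong (λ t → at (y ++ reverse y) (t + j)) |y|≡r ⟩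
    at (y ++ reverse y) (r + j)        ≡⟨ cong (λ t → at t (r + j)) s≡ ⟨
    at s (r + j)                       ≡⟨ at-slice a (2 * r) w r+j<2r ⟩
    at w (a + (r + j))                 ≡⟨ cong (at w) (trans (sym (+-assoc a r j)) (cong (_+ j) a+r≡c)) ⟩
    at w (c + j)                       ∎
    where
    open ≡-Reasoning
    a = c ∸ r
    s = slice a (2 * r) w
    i = r ∸ suc j
    a+r≡c : a + r ≡ c
    a+r≡c = m∸n+n≡m r≤c
    i+j≡r : i + suc j ≡ r
    i+j≡r = m∸n+n≡m j<r
    k≡a+i : k ≡ a + i
    k≡a+i = +-cancelʳ-≡ (suc j) k (a + i)
              (trans eq (trans (sym a+r≡c) (trans (cong (a +_) (sym i+j≡r)) (sym (+-assoc a i (suc j))))))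
    i<2r : i < 2 * r
    i<2r = subst (i <_) (sym (twice r)) (≤-trans (summand<ˡ i+j≡r) (m≤m+n r r))
    r+j<2r : r + j < 2 * r
    r+j<2r = subst (r + j <_) (sym (twice r)) (+-monoʳ-< r j<r)
    a+2r≤ : a + 2 * r ≤ length w
    a+2r≤ = subst (_≤ length w)
              (sym (trans (cong (a +_) (twice r)) (trans (sym (+-assoc a r r)) (cong (_+ r) a+r≡c))))
              c+r≤
    |y|≡r : length y ≡ r
    |y|≡r = double-injective (begin
      length y + length y           ≡⟨ cong (length y +_) (length-reverse y) ⟨
      length y + length (reverse y) ≡⟨ length-++ y ⟨
      length (y ++ reverse y)       ≡⟨ cong length s≡ ⟨
      length s                      ≡⟨ length-slice a (2 * r) w a+2r≤ ⟩
      2 * r                         ≡⟨ twice r ⟩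
      r + r                         ∎)

  length-first-third : ∀ (v : List A) a δ → a + δ + δ + δ ≤ length v → length (slice a δ v) ≡ δ
  length-first-third v a δ bound =
    length-slice a δ v (≤-trans (≤-trans (m≤m+n (a + δ) δ) (m≤m+n (a + δ + δ) δ)) bound)

  adjacent-mirrors⇒Z : ∀ (v : List A) a δ → a + δ + δ + δ ≤ length v →
    Mirror v (a + δ) δ → Mirror v (a + δ + δ) δ →
    drop a v ≡ (slice a δ v ++ reverse (slice a δ v) ++ slice a δ v) ++ drop (a + δ + δ + δ) v
  adjacent-mirrors⇒Z v a δ bound m₁ m₂ = begin
    drop a v                       ≡⟨ drop-slice a δ v ⟩
    x ++ drop (a + δ) v            ≡⟨ cong (x ++_) (drop-slice (a + δ) δ v) ⟩
    x ++ y ++ drop (a + δ + δ) v   ≡⟨ cong (λ t → x ++ y ++ t) (drop-slice (a + δ + δ) δ v) ⟩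
    x ++ y ++ z ++ rest            ≡⟨ cong₂ (λ p q → x ++ p ++ q ++ rest) y≡x̄ z≡x ⟩
    x ++ reverse x ++ x ++ rest    ≡⟨ cong (x ++_) (++-assoc (reverse x) x rest) ⟨
    x ++ (reverse x ++ x) ++ rest  ≡⟨ ++-assoc x (reverse x ++ x) rest ⟨
    (x ++ reverse x ++ x) ++ rest  ∎
    where
    open ≡-Reasoning
    x = slice a δ v
    y = slice (a + δ) δ v
    z = slice (a + δ + δ) δ v
    rest = drop (a + δ + δ + δ) v
    |x|≡δ : length x ≡ δ
    |x|≡δ = length-first-third v a δ bound
    |y|≡δ : length y ≡ δ
    |y|≡δ = length-slice (a + δ) δ v (≤-trans (m≤m+n (a + δ + δ) δ) bound)
    |z|≡δ : length z ≡ δ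
    |z|≡δ = length-slice (a + δ + δ) δ v bound
    y≡x̄ : y ≡ reverse x
    y≡x̄ = at-ext y (reverse x) (trans |y|≡δ (sym (trans (length-reverse x) |x|≡δ))) λ j j< →
      let j<δ = subst (j <_) |y|≡δ j<
          i+j≡δ = m∸n+n≡m j<δ
          i = δ ∸ suc j
      in begin
        at y j           ≡⟨ at-slice (a + δ) δ v j<δ ⟩
        at v (a + δ + j) ≡⟨ m₁ j<δ (shift a i+j≡δ) ⟨
        at v (a + i)     ≡⟨ at-slice a δ v (summand<ˡ i+j≡δ) ⟨
        at x i           ≡⟨ at-reverse x (trans (+-suc-swap j i) (trans i+j≡δ (sym |x|≡δ))) ⟨
        at (reverse x) j ∎
    z≡x : z ≡ x
    z≡x = at-ext z x (trans |z|≡δ (sym |x|≡δ)) λ j j< →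
      let j<δ = subst (j <_) |z|≡δ j<
          i+j≡δ = m∸n+n≡m j<δ
          i = δ ∸ suc j
      in begin
        at z j               ≡⟨ at-slice (a + δ + δ) δ v j<δ ⟩
        at v (a + δ + δ + j) ≡⟨ m₂ j<δ (shift (a + δ) i+j≡δ) ⟨
        at v (a + δ + i)     ≡⟨ m₁ (summand<ˡ i+j≡δ) (shift a (trans (+-suc-swap j i) i+j≡δ)) ⟨
        at v (a + j)         ≡⟨ at-slice a δ v j<δ ⟨
        at x j               ∎

  adjacent-mirrors-reducible : ∀ (v : List A) a δ → Irreducible v → 0 < δ →
    a + δ + δ + δ ≤ length v → Mirror v (a + δ) δ → Mirror v (a + δ + δ) δ → ⊥
  adjacent-mirrors-reducible v a δ irr 0<δ bound m₁ m₂ =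
    irr (take a v , x ++ reverse x ++ x , drop (a + δ + δ + δ) v , (x , x≢[] , refl) , v≡)
    where
    x = slice a δ v
    v≡ : v ≡ take a v ++ (x ++ reverse x ++ x) ++ drop (a + δ + δ + δ) v
    v≡ = trans (sym (take++drop≡id a v)) (cong (take a v ++_) (adjacent-mirrors⇒Z v a δ bound m₁ m₂))
    x≢[] : x ≢ []
    x≢[] x≡[] = <-irrefl (trans (sym (cong length x≡[])) (length-first-third v a δ bound)) 0<δ

  -- Otherwise, with δ = d - c,
  -- the mirrors of radius δ at c and at d = c + δ spell a Z-shape inside
  -- w[1 : |w|-1], which ends at d + δ < d + rd ≤ |w|.
  inner-radius-bound : ∀ (w : List A) → PPIrreducible w → ∀ {c rc d rd} →
    Admissible w c rc → Admissible w d rd → c < d → d ≤ c + rc → c + rd ≤ d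
  inner-radius-bound w irr {c} {rc} {d} {rd} adm-c@(rc≤c , _) adm-d@(_ , d+rd≤|w| , _) c<d d≤c+rc
    with c + rd ≤? d
  ... | yes c+rd≤d = c+rd≤d
  ... | no  c+rd≰d = ⊥-elim (adjacent-mirrors-reducible v a δ irr 0<δ bound mirror-c mirror-d)
    where
    n = length w ∸ 1
    v = take n w
    δ = d ∸ c
    a = c ∸ δ
    c+δ≡d : c + δ ≡ d
    c+δ≡d = m+[n∸m]≡n (<⇒≤ c<d)
    0<δ : 0 < δ
    0<δ = +-cancelˡ-< c 0 δ (subst₂ _<_ (sym (+-identityʳ c)) (sym c+δ≡d) c<d)
    δ≤rc : δ ≤ rc
    δ≤rc = +-cancelˡ-≤ c δ rc (subst (_≤ c + rc) (sym c+δ≡d) d≤c+rc)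
    δ<rd : δ < rd
    δ<rd = +-cancelˡ-< c δ rd (subst (_< c + rd) (sym c+δ≡d) (≰⇒> c+rd≰d))
    a+δ≡c : a + δ ≡ c
    a+δ≡c = m∸n+n≡m (≤-trans δ≤rc rc≤c)
    a+2δ≡d : a + δ + δ ≡ d
    a+2δ≡d = trans (cong (_+ δ) a+δ≡c) c+δ≡d
    d+δ≤n : d + δ ≤ n
    d+δ≤n = subst (d + δ ≤_) (pred[m∸n]≡m∸[1+n] (length w) 0)
              (<⇒≤pred (<-≤-trans (+-monoʳ-< d δ<rd) d+rd≤|w|))
    c+δ≤n : c + δ ≤ n
    c+δ≤n = subst (_≤ n) (sym c+δ≡d) (≤-trans (m≤m+n d δ) d+δ≤n)
    bound : a + δ + δ + δ ≤ length v
    bound = subst₂ _≤_ (sym (cong (_+ δ) a+2δ≡d))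
              (sym (trans (length-take n w) (m≤n⇒m⊓n≡m (m∸n≤m (length w) 1)))) d+δ≤n
    mirror-c : Mirror v (a + δ) δ
    mirror-c = subst (λ t → Mirror v t δ) (sym a+δ≡c)
                 (mirror-take w n c+δ≤n (mirror-shrink w δ≤rc (admissible⇒mirror w adm-c)))
    mirror-d : Mirror v (a + δ + δ) δ
    mirror-d = subst (λ t → Mirror v t δ) (sym a+2δ≡d)
                 (mirror-take w n d+δ≤n (mirror-shrink w (<⇒≤ δ<rd) (admissible⇒mirror w adm-d)))

  ⊏-intro : ∀ (w : List A) → PPIrreducible w → ∀ {c rc d rd} → IsRho w c rc → IsRho w d rd →
    c ≢ d → c ≤ d → d ≤ c + rc → c + rc ≤ d + rd → c ⊏[ w ] d
  ⊏-intro w irr {d = d} {rd} ρc ρd c≢d c≤d d≤c+rc reach =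
    c≢d , _ , _ , ρc , ρd ,
    inner-radius-bound w irr (proj₁ ρc) (proj₁ ρd) (≤∧≢⇒< c≤d c≢d) d≤c+rc ,
    m∸n≤m d rd , d≤c+rc , reach

  start≤frontier : ∀ {w : List A} {x f} → Chain w x f → x ≤ f
  start≤frontier (done {c} {r} _) = m≤m+n c r
  start≤frontier (step {c} (_ , _ , rd , _ , _ , c+rd≤d , _) rest) =
    ≤-trans (≤-trans (m≤m+n c rd) c+rd≤d) (start≤frontier rest)

  Dominates : List A → ℕ → ℕ → Set
  Dominates w x d = ∀ {g} → Chain w d g → ∃ λ g′ → Chain w x g′ × g ≤ g′

  F-dominated : ∀ {w : List A} {x d f g} → Dominates w x d → IsF w x f → IsF w d g → g ≤ f
  F-dominated dom (_ , max-x) (chain-d , _) with dom chain-d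
  ... | g′ , chain-x , g≤g′ = ≤-trans g≤g′ (max-x g′ chain-x)

  dominates-step : ∀ {w : List A} {x y d} → x ⊏[ w ] y → Dominates w y d → Dominates w x d
  dominates-step x⊏y dom chain-d with dom chain-d
  ... | g′ , chain-y , g≤g′ = g′ , step x⊏y chain-y , g≤g′

  -- Walk along a
  -- chain from d: as soon as a palindrome on it reaches c + ρ(c), link c to
  -- it; if none does, the palindrome at c itself outreaches the chain.
  rho-dominates : ∀ (w : List A) → PPIrreducible w → ∀ {c rc d} → IsRho w c rc →
    c ≤ d → d ≤ c + rc → Dominates w c d
  rho-dominates w irr {c} {d = d} ρc c≤d d≤c+rc chain-d with c ≟ d
  rho-dominates w irr ρc c≤d d≤c+rc chain-d | yes refl = _ , chain-d , ≤-refl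
  rho-dominates w irr {c} {rc} ρc c≤d d≤c+rc (done {r = rd} ρd) | no c≢d with c + rc ≤? _ + rd
  ... | yes reach = _ , step (⊏-intro w irr ρc ρd c≢d c≤d d≤c+rc reach) (done ρd) , ≤-refl
  ... | no  short = _ , done ρc , <⇒≤ (≰⇒> short)
  rho-dominates w irr {c} {rc} ρc c≤d d≤c+rc
    chain-d@(step (_ , rd , re , ρd , _ , d+re≤e , _ , e≤d+rd , _) rest) | no c≢d with c + rc ≤? _ + rd
  ... | yes reach = _ , step (⊏-intro w irr ρc ρd c≢d c≤d d≤c+rc reach) chain-d , ≤-refl
  ... | no  short = rho-dominates w irr ρc (≤-trans c≤d (≤-trans (m≤m+n _ re) d+re≤e))
                      (≤-trans e≤d+rd (<⇒≤ (≰⇒> short))) rest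

  chain-dominates : ∀ (w : List A) → PPIrreducible w → ∀ {x f d} → Chain w x f →
    x ≤ d → d ≤ f → Dominates w x d
  chain-dominates w irr (done ρx) x≤d d≤f = rho-dominates w irr ρx x≤d d≤f
  chain-dominates w irr {d = d} (step {d = y} x⊏y@(_ , _ , _ , ρx , _ , _ , _ , y≤x+rx , _) rest) x≤d d≤f
    with d ≤? y
  ... | yes d≤y = rho-dominates w irr ρx x≤d (≤-trans d≤y y≤x+rx)
  ... | no  d≰y = dominates-step x⊏y (chain-dominates w irr rest (<⇒≤ (≰⇒> d≰y)) d≤f)

-- Positions d ≤ c obey the bound by hypothesis; a position d ∈ (c, f] lies
-- within the frontier of an optimal chain from the maximiser d₀ ≤ c, which
-- therefore dominates d.
corollary4 : {A : Set} (w : List A) (b c f : ℕ) →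
    PPIrreducible w → 1 ≤ b → b ≤ c → c ≤ length w →
    IsMaxF w b c f → IsMaxF w b f f
corollary4 w b c f irr _ _ _ ((d₀ , b≤d₀ , d₀≤c , F-d₀@(chain-d₀ , _)) , bounded-to-c) =
  (d₀ , b≤d₀ , start≤frontier chain-d₀ , F-d₀) , bounded-to-f
  where
  bounded-to-f : ∀ d g → b ≤ d → d ≤ f → IsF w d g → g ≤ f
  bounded-to-f d g b≤d d≤f F-d with d ≤? c
  ... | yes d≤c = bounded-to-c d g b≤d d≤c F-d
  ... | no  d≰c = F-dominated (chain-dominates w irr chain-d₀ (≤-trans d₀≤c (<⇒≤ (≰⇒> d≰c))) d≤f) F-d₀ F-d
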